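{- If $G$ is a subgraph of a graph $H$, then the complex of enclaveless sets $El(G)$ is a subcomplex of $El(H)$.
   Context: A graph is a finite simplicial complex of dimension at most 1. For a vertex $v$ of a graph $G=(V,E)$, $N_G(v)=\{v\}\cup\{u\in V\mid\langle v,u\rangle\in E\}$. A set $Y\subseteq V$ is enclaveless in $G$ if there is no $v\in Y$ with $N_G(v)\subseteq Y$. $El(G)$ is the simplicial complex whose simplices are the nonempty enclaveless sets of $G$. -}

module Defs where

open import Data.Nat using (ℕ)
open import Data.Fin using (Fin)
open import Data.Fin.Subset using (Subset; _∈_; _⊆_; Nonempty)
open import Data.Product using (_×_; ∃)
open import Data.Sum using (_⊎_)
open import Relation.Nullary using (¬_)
open import Relation.Binary.PropositionalEquality using (_≡_)

record Graph (n : ℕ) : Set₁ where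
  field
    V       : Subset n
    E       : Fin n → Fin n → Set
    E-sym   : ∀ {u v} → E u v → E v u
    E-irr   : ∀ {v} → ¬ E v v
    E-in-V  : ∀ {u v} → E u v → u ∈ V
open Graph public

N : ∀ {n} → Graph n → Fin n → Fin n → Set
N G v u = u ≡ v ⊎ E G v u

Enclaveless : ∀ {n} → Graph n → Subset n → Set
Enclaveless G Y = Y ⊆ V G × ¬ (∃ λ v → v ∈ Y × (∀ u → N G v u → u ∈ Y))

ElSimplex : ∀ {n} → Graph n → Subset n → Set
ElSimplex G Y = Nonempty Y × Enclaveless G Y

Subgraph : ∀ {n} → Graph n → Graph n → Set
Subgraph G H = (V G ⊆ V H) × (∀ u v → E G u v → E H u v)

_⊑_ : ∀ {n} → (Subset n → Set) → (Subset n → Set) → Set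
K ⊑ L = ∀ Y → K Y → L Y

module Submission where

open import Data.Fin.Subset using (Subset; _∈_)
open import Data.Product using (_,_; map₂)
import Data.Sum as Sum
open import Function using (_∘_)

open import Defs

N-mono : ∀ {n} (G H : Graph n) → Subgraph G H → ∀ v u → N G v u → N H v u
N-mono G H (_ , E⊆E) v u = Sum.map₂ (E⊆E v u)

-- Enlarging neighbourhoods can only destroy enclaves, never create them.
enclave-antimono : ∀ {n} (G H : Graph n) {Y : Subset n} → Subgraph G H →
                   ∀ v → (∀ u → N H v u → u ∈ Y) → ∀ u → N G v u → u ∈ Y
enclave-antimono G H G⊆H v N⊆Y u = N⊆Y u ∘ N-mono G H G⊆H v u

Enclaveless-mono : ∀ {n} (G H : Graph n) → Subgraph G H →
                   ∀ Y → Enclaveless G Y → Enclaveless H Y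
Enclaveless-mono G H G⊆H@(V⊆V , _) Y (Y⊆V , noEnclave) =
  V⊆V ∘ Y⊆V ,
  λ { (v , v∈Y , N⊆Y) → noEnclave (v , v∈Y , enclave-antimono G H G⊆H v N⊆Y) }

proposition6 : ∀ {n} (G H : Graph n) → Subgraph G H → ElSimplex G ⊑ ElSimplex H
proposition6 G H G⊆H Y = map₂ (Enclaveless-mono G H G⊆H Y)
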